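{- For any cut-free derivations $f, g$ of the same sequent $S \mid \Gamma \vdash C$, we have $f \circeq g$ if and only if $\mathrm{focus}\, f = \mathrm{focus}\, g$.
   Context: Fix a set $\mathrm{Var}$ of atoms. Formulae: atoms $X \in \mathrm{Var}$, $\mathsf{I}$, and $A \otimes B$. A context is a finite list of formulae; a stoup $S$ is either empty ($-$) or a single formula; a stoup $T$ is irreducible if $T = -$ or $T$ is an atom. Cut-free sequent calculus: sequents $S \mid \Gamma \vdash C$ derived by (ax) $A \mid\ \vdash A$; (pass) from $A \mid \Gamma \vdash C$ infer $- \mid A, \Gamma \vdash C$; ($\mathsf I$L) from $- \mid \Gamma \vdash C$ infer $\mathsf I \mid \Gamma \vdash C$; ($\mathsf I$R) $- \mid\ \vdash \mathsf I$; ($\otimes$L) from $A \mid B, \Gamma \vdash C$ infer $A \otimes B \mid \Gamma \vdash C$; ($\otimes$R) from $S \mid \Gamma \vdash A$ and $- \mid \Delta \vdash B$ infer $S \mid \Gamma, \Delta \vdash A \otimes B$. The relation $\circeq$ is the least congruence on cut-free derivations (w.r.t. all rules) containing: $\mathrm{ax}_{\mathsf I} \circeq \mathsf{I}\mathrm{L}(\mathsf I\mathrm R)$; $\mathrm{ax}_{A \otimes B} \circeq \otimes\mathrm L(\otimes\mathrm R(\mathrm{ax}_A, \mathrm{pass}(\mathrm{ax}_B)))$; $\otimes\mathrm R(\mathrm{pass}\, f, g) \circeq \mathrm{pass}(\otimes\mathrm R(f, g))$; $\otimes\mathrm R(\mathsf I\mathrm L\, f, g) \circeq \mathsf I\mathrm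 L(\otimes\mathrm R(f, g))$; $\otimes\mathrm R(\otimes\mathrm L\, f, g) \circeq \otimes\mathrm L(\otimes\mathrm R(f, g))$. Focused calculus: sequents $S \mid \Gamma \vdash_{\mathsf L} C$ and $T \mid \Gamma \vdash_{\mathsf R} C$ ($T$ irreducible), derived by: (pass) from $A \mid \Gamma \vdash_{\mathsf L} C$ infer $- \mid A, \Gamma \vdash_{\mathsf L} C$; (switch) from $T \mid \Gamma \vdash_{\mathsf R} C$ infer $T \mid \Gamma \vdash_{\mathsf L} C$; (ax$_X$) $X \mid\ \vdash_{\mathsf R} X$ for atoms $X$; ($\mathsf I$L) from $- \mid \Gamma \vdash_{\mathsf L} C$ infer $\mathsf I \mid \Gamma \vdash_{\mathsf L} C$; ($\mathsf I$R$_{\mathsf R}$) $- \mid\ \vdash_{\mathsf R} \mathsf I$; ($\otimes$L) from $A \mid B, \Gamma \vdash_{\mathsf L} C$ infer $A \otimes B \mid \Gamma \vdash_{\mathsf L} C$; ($\otimes$R$_{\mathsf R}$) from $T \mid \Gamma \vdash_{\mathsf R} A$ and $- \mid \Delta \vdash_{\mathsf L} B$ infer $T \mid \Gamma, \Delta \vdash_{\mathsf R} A \otimes B$. $\mathrm{focus}$ maps cut-free derivations of $S \mid \Gamma \vdash C$ to focused derivations of $S \mid \Gamma \vdash_{\mathsf L} C$: $\mathrm{focus}(\mathrm{pass}\, f) = \mathrm{pass}(\mathrm{focus}\, f)$, $\mathrm{focus}(\mathsf I\mathrm L\, f) = \mathsf I\mathrm L(\mathrm{focus}\, f)$, $\mathrm{focus}(\otimes\mathrm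 L\, f) = \otimes\mathrm L(\mathrm{focus}\, f)$, $\mathrm{focus}(\mathsf I\mathrm R) = \mathrm{switch}(\mathsf I\mathrm R_{\mathsf R})$, $\mathrm{focus}(\otimes\mathrm R(f, g)) = \otimes\mathrm R_{\mathsf L}(\mathrm{focus}\, f, \mathrm{focus}\, g)$, $\mathrm{focus}(\mathrm{ax}_A) = \mathrm{ax}_{\mathsf L, A}$, where $\otimes\mathrm R_{\mathsf L}$ is defined by recursion on its first argument: $\otimes\mathrm R_{\mathsf L}(\mathrm{pass}\, f, g) = \mathrm{pass}(\otimes\mathrm R_{\mathsf L}(f, g))$, $\otimes\mathrm R_{\mathsf L}(\mathsf I\mathrm L\, f, g) = \mathsf I\mathrm L(\otimes\mathrm R_{\mathsf L}(f, g))$, $\otimes\mathrm R_{\mathsf L}(\otimes\mathrm L\, f, g) = \otimes\mathrm L(\otimes\mathrm R_{\mathsf L}(f, g))$, $\otimes\mathrm R_{\mathsf L}(\mathrm{switch}\, f, g) = \mathrm{switch}(\otimes\mathrm R_{\mathsf R}(f, g))$; and $\mathrm{ax}_{\mathsf L, X} = \mathrm{switch}(\mathrm{ax}_X)$, $\mathrm{ax}_{\mathsf L, \mathsf I} = \mathsf I\mathrm L(\mathrm{switch}(\mathsf I\mathrm R_{\mathsf R}))$, $\mathrm{ax}_{\mathsf L, A \otimes B} = \otimes\mathrm L(\otimes\mathrm R_{\mathsf L}(\mathrm{ax}_{\mathsf L, A}, \mathrm{pass}(\mathrm{ax}_{\mathsf L, B})))$. -}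

module Defs where

open import Data.List using (List; []; _∷_; _++_)
open import Data.Maybe using (Maybe; just; nothing)
open import Relation.Binary.PropositionalEquality using (_≡_)

data Fma (Var : Set) : Set where
  ` : Var → Fma Var
  I : Fma Var
  _⊗_ : Fma Var → Fma Var → Fma Var

infixl 25 _⊗_

-- Stoups: nothing = empty stoup (-), just A = single formula A
Stp : Set → Set
Stp Var = Maybe (Fma Var)

Cxt : Set → Set
Cxt Var = List (Fma Var)

data Irr (Var : Set) : Set where
  ─ : Irr Var
  at : Var → Irr Var

irr : {Var : Set} → Irr Var → Stp Var
irr ─ = nothing
irr (at X) = just (` X)

module _ {Var : Set} where

  infix 15 _∣_⊢_
  data _∣_⊢_ : Stp Var → Cxt Var → Fma Var → Set where
    ax : {A : Fma Var} → just A ∣ [] ⊢ A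
    pass : {Γ : Cxt Var} {A C : Fma Var} →
      just A ∣ Γ ⊢ C → nothing ∣ A ∷ Γ ⊢ C
    Il : {Γ : Cxt Var} {C : Fma Var} →
      nothing ∣ Γ ⊢ C → just I ∣ Γ ⊢ C
    Ir : nothing ∣ [] ⊢ I
    ⊗l : {Γ : Cxt Var} {A B C : Fma Var} →
      just A ∣ B ∷ Γ ⊢ C → just (A ⊗ B) ∣ Γ ⊢ C
    ⊗r : {S : Stp Var} {Γ Δ : Cxt Var} {A B : Fma Var} →
      S ∣ Γ ⊢ A → nothing ∣ Δ ⊢ B → S ∣ Γ ++ Δ ⊢ A ⊗ B

  infix 5 _≗_
  data _≗_ : {S : Stp Var} {Γ : Cxt Var} {C : Fma Var} →
             S ∣ Γ ⊢ C → S ∣ Γ ⊢ C → Set where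
    refl : ∀ {S Γ C} {f : S ∣ Γ ⊢ C} → f ≗ f
    ~_ : ∀ {S Γ C} {f g : S ∣ Γ ⊢ C} → f ≗ g → g ≗ f
    _∙_ : ∀ {S Γ C} {f g h : S ∣ Γ ⊢ C} → f ≗ g → g ≗ h → f ≗ h
    pass : ∀ {Γ A C} {f g : just A ∣ Γ ⊢ C} → f ≗ g → pass f ≗ pass g
    Il : ∀ {Γ C} {f g : nothing ∣ Γ ⊢ C} → f ≗ g → Il f ≗ Il g
    ⊗l : ∀ {Γ A B C} {f g : just A ∣ B ∷ Γ ⊢ C} → f ≗ g → ⊗l f ≗ ⊗l g
    ⊗r : ∀ {S Γ Δ A B} {f g : S ∣ Γ ⊢ A} {f' g' : nothing ∣ Δ ⊢ B} →
      f ≗ g → f' ≗ g' → ⊗r f f' ≗ ⊗r g g'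
    axI : ax ≗ Il Ir
    ax⊗ : ∀ {A B} → ax {A ⊗ B} ≗ ⊗l (⊗r ax (pass ax))
    ⊗rpass : ∀ {Γ Δ A' A B} {f : just A' ∣ Γ ⊢ A} {g : nothing ∣ Δ ⊢ B} →
      ⊗r (pass f) g ≗ pass (⊗r f g)
    ⊗rIl : ∀ {Γ Δ A B} {f : nothing ∣ Γ ⊢ A} {g : nothing ∣ Δ ⊢ B} →
      ⊗r (Il f) g ≗ Il (⊗r f g)
    ⊗r⊗l : ∀ {Γ Δ A' B' A B} {f : just A' ∣ B' ∷ Γ ⊢ A} {g : nothing ∣ Δ ⊢ B} →
      ⊗r (⊗l f) g ≗ ⊗l (⊗r f g)

  infix 15 _∣_⊢L_ _∣_⊢R_
  data _∣_⊢L_ : Stp Var → Cxt Var → Fma Var → Set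
  data _∣_⊢R_ : Irr Var → Cxt Var → Fma Var → Set

  data _∣_⊢L_ where
    pass : {Γ : Cxt Var} {A C : Fma Var} →
      just A ∣ Γ ⊢L C → nothing ∣ A ∷ Γ ⊢L C
    switch : {T : Irr Var} {Γ : Cxt Var} {C : Fma Var} →
      T ∣ Γ ⊢R C → irr T ∣ Γ ⊢L C
    Il : {Γ : Cxt Var} {C : Fma Var} →
      nothing ∣ Γ ⊢L C → just I ∣ Γ ⊢L C
    ⊗l : {Γ : Cxt Var} {A B C : Fma Var} →
      just A ∣ B ∷ Γ ⊢L C → just (A ⊗ B) ∣ Γ ⊢L C

  data _∣_⊢R_ where
    ax : {X : Var} → at X ∣ [] ⊢R ` X
    Ir : ─ ∣ [] ⊢R I
    ⊗r : {T : Irr Var} {Γ Δ : Cxt Var} {A B : Fma Var} →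
      T ∣ Γ ⊢R A → nothing ∣ Δ ⊢L B → T ∣ Γ ++ Δ ⊢R A ⊗ B

  ⊗rL : {S : Stp Var} {Γ Δ : Cxt Var} {A B : Fma Var} →
    S ∣ Γ ⊢L A → nothing ∣ Δ ⊢L B → S ∣ Γ ++ Δ ⊢L A ⊗ B
  ⊗rL (pass f) g = pass (⊗rL f g)
  ⊗rL (switch f) g = switch (⊗r f g)
  ⊗rL (Il f) g = Il (⊗rL f g)
  ⊗rL (⊗l f) g = ⊗l (⊗rL f g)

  axL : {A : Fma Var} → just A ∣ [] ⊢L A
  axL {` X} = switch ax
  axL {I} = Il (switch Ir)
  axL {A ⊗ B} = ⊗l (⊗rL axL (pass axL))

  focus : {S : Stp Var} {Γ : Cxt Var} {C : Fma Var} →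
    S ∣ Γ ⊢ C → S ∣ Γ ⊢L C
  focus ax = axL
  focus (pass f) = pass (focus f)
  focus (Il f) = Il (focus f)
  focus Ir = switch Ir
  focus (⊗l f) = ⊗l (focus f)
  focus (⊗r f g) = ⊗rL (focus f) (focus g)

-- focus is invariant under ≗ because every generating equation of ≗ holds
-- definitionally after focusing. Conversely, the embedding of focused
-- derivations back into the sequent calculus is a left inverse of focus up
-- to ≗, so focus f ≡ focus g gives f ≗ emb (focus f) ≡ emb (focus g) ≗ g.
module Submission where

open import Defs
open import Data.Product using (_×_; _,_)
open import Data.Maybe using (nothing)
open import Relation.Binary.PropositionalEquality as ≡ using (_≡_; cong; cong₂)

module _ {Var : Set} where

  focus-resp-≗ : {S : Stp Var} {Γ : Cxt Var} {C : Fma Var} {f g : S ∣ Γ ⊢ C} →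
    f ≗ g → focus f ≡ focus g
  focus-resp-≗ refl = ≡.refl
  focus-resp-≗ (~ p) = ≡.sym (focus-resp-≗ p)
  focus-resp-≗ (p ∙ q) = ≡.trans (focus-resp-≗ p) (focus-resp-≗ q)
  focus-resp-≗ (pass p) = cong pass (focus-resp-≗ p)
  focus-resp-≗ (Il p) = cong Il (focus-resp-≗ p)
  focus-resp-≗ (⊗l p) = cong ⊗l (focus-resp-≗ p)
  focus-resp-≗ (⊗r p q) = cong₂ ⊗rL (focus-resp-≗ p) (focus-resp-≗ q)
  focus-resp-≗ axI = ≡.refl
  focus-resp-≗ ax⊗ = ≡.refl
  focus-resp-≗ ⊗rpass = ≡.refl
  focus-resp-≗ ⊗rIl = ≡.refl
  focus-resp-≗ ⊗r⊗l = ≡.refl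

  ≡⇒≗ : {S : Stp Var} {Γ : Cxt Var} {C : Fma Var} {f g : S ∣ Γ ⊢ C} →
    f ≡ g → f ≗ g
  ≡⇒≗ ≡.refl = refl

  embL : {S : Stp Var} {Γ : Cxt Var} {C : Fma Var} → S ∣ Γ ⊢L C → S ∣ Γ ⊢ C
  embR : {T : Irr Var} {Γ : Cxt Var} {C : Fma Var} → T ∣ Γ ⊢R C → irr T ∣ Γ ⊢ C
  embL (pass f) = pass (embL f)
  embL (switch f) = embR f
  embL (Il f) = Il (embL f)
  embL (⊗l f) = ⊗l (embL f)
  embR ax = ax
  embR Ir = Ir
  embR (⊗r f g) = ⊗r (embR f) (embL g)

  embL-⊗rL : {S : Stp Var} {Γ Δ : Cxt Var} {A B : Fma Var}
    (f : S ∣ Γ ⊢L A) (g : nothing ∣ Δ ⊢L B) →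
    embL (⊗rL f g) ≗ ⊗r (embL f) (embL g)
  embL-⊗rL (pass f) g = pass (embL-⊗rL f g) ∙ (~ ⊗rpass)
  embL-⊗rL (switch f) g = refl
  embL-⊗rL (Il f) g = Il (embL-⊗rL f g) ∙ (~ ⊗rIl)
  embL-⊗rL (⊗l f) g = ⊗l (embL-⊗rL f g) ∙ (~ ⊗r⊗l)

  embL-axL : {A : Fma Var} → embL (axL {A = A}) ≗ ax
  embL-axL {` X} = refl
  embL-axL {I} = ~ axI
  embL-axL {A ⊗ B} =
    ⊗l (embL-⊗rL axL (pass axL) ∙ ⊗r embL-axL (pass embL-axL)) ∙ (~ ax⊗)

  embL∘focus : {S : Stp Var} {Γ : Cxt Var} {C : Fma Var} (f : S ∣ Γ ⊢ C) →
    embL (focus f) ≗ f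
  embL∘focus ax = embL-axL
  embL∘focus (pass f) = pass (embL∘focus f)
  embL∘focus (Il f) = Il (embL∘focus f)
  embL∘focus Ir = refl
  embL∘focus (⊗l f) = ⊗l (embL∘focus f)
  embL∘focus (⊗r f g) =
    embL-⊗rL (focus f) (focus g) ∙ ⊗r (embL∘focus f) (embL∘focus g)

  focus-injective-≗ : {S : Stp Var} {Γ : Cxt Var} {C : Fma Var} {f g : S ∣ Γ ⊢ C} →
    focus f ≡ focus g → f ≗ g
  focus-injective-≗ {f = f} {g} eq =
    (~ embL∘focus f) ∙ (≡⇒≗ (cong embL eq) ∙ embL∘focus g)

corollary5p7 : {Var : Set} {S : Stp Var} {Γ : Cxt Var} {C : Fma Var} →
    (f g : S ∣ Γ ⊢ C) → (f ≗ g → focus f ≡ focus g) × (focus f ≡ focus g → f ≗ g)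
corollary5p7 f g = focus-resp-≗ , focus-injective-≗
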